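{- For each $K\in\mathbb{N}$, there exists a $\Delta\in\mathbb{N}$ such that the following holds. If $G$ is a finite graph with $\delta(x,y)\le K$ for all $x,y\in V(G)$, then either $G$ or its complement $\overline{G}$ has maximum degree at most $\Delta$.
   Context: For a graph $G$ and a vertex $x$, $\Gamma(x)$ denotes the neighbourhood of $x$. The neighbourhood-distance between two vertices $x,y$ is $\delta(x,y)=|(\Gamma(x)\setminus \{y\})\triangle (\Gamma(y)\setminus\{x\})|$, where $\triangle$ denotes symmetric difference. -}

module Defs where

open import Data.Nat using (ℕ; _≤_)
open import Data.Bool using (Bool; true; false; not; _xor_; _∧_; T?)
open import Data.Fin using (Fin)
open import Data.Fin.Properties using (_≟_)
open import Data.List using (List; length; filter)
open import Data.List.Base using (allFin)
open import Relation.Binary.PropositionalEquality using (_≡_)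
open import Relation.Nullary using (¬_; Dec; yes; no)
open import Relation.Nullary.Decidable using (⌊_⌋)
open import Function using (_∘_)

record Graph (n : ℕ) : Set where
  field
    adj       : Fin n → Fin n → Bool
    adj-sym   : ∀ x y → adj x y ≡ adj y x
    adj-irrefl : ∀ x → adj x x ≡ false
open Graph public

countV : ∀ {n} → (Fin n → Bool) → ℕ
countV {n} p = length (filter (λ z → T? (p z)) (allFin n))

degree : ∀ {n} → Graph n → Fin n → ℕ
degree G x = countV (adj G x)

-- neighbourhood-distance δ(x,y) = |(Γ(x) ∖ {y}) △ (Γ(y) ∖ {x})|
-- z ∈ Γ(x)∖{y} iff adj x z ∧ z ≠ y
nbdist : ∀ {n} → Graph n → Fin n → Fin n → ℕ
nbdist G x y = countV (λ z → (adj G x z ∧ not ⌊ z ≟ y ⌋) xor (adj G y z ∧ not ⌊ z ≟ x ⌋))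

complement : ∀ {n} → Graph n → Graph n
complement {n} G = record
  { adj = cadj
  ; adj-sym = csym
  ; adj-irrefl = cirr }
  where
  open import Relation.Binary.PropositionalEquality using (refl; sym; cong)
  cadj : Fin n → Fin n → Bool
  cadj x y with x ≟ y
  ... | yes _ = false
  ... | no _  = not (adj G x y)
  csym : ∀ x y → cadj x y ≡ cadj y x
  csym x y with x ≟ y | y ≟ x
  ... | yes _ | yes _ = refl
  ... | yes p | no q = Data.Empty.⊥-elim (q (sym p))
    where import Data.Empty
  ... | no p | yes q = Data.Empty.⊥-elim (p (sym q))
    where import Data.Empty
  ... | no _ | no _ = cong not (adj-sym G x y)
  cirr : ∀ x → cadj x x ≡ false
  cirr x with x ≟ x
  ... | yes _ = refl
  ... | no p = Data.Empty.⊥-elim (p refl)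
    where import Data.Empty

MaxDegreeAtMost : ∀ {n} → Graph n → ℕ → Set
MaxDegreeAtMost G D = ∀ x → degree G x ≤ D

-- Fix x and w and count the pairs (a, b) with a ∈ Γ(x), b a non-neighbour of w other than w, and a ≠ b.
-- Such a pair is separated either by b (if a ~ b, then b ∈ Γ(a) △ Γ(w)) or by a (if a ≁ b, then
-- a ∈ Γ(x) △ Γ(b)), so there are at most K (deg x + deg̅ w) pairs, while there are at least
-- deg x (deg̅ w − 1). These bounds are incompatible once both degrees exceed 2K + 1.
module Submission where

open import Defs
open import Data.Nat using (ℕ; zero; suc; _+_; _*_; _≤_; _<_; _≤?_; z≤n; s≤s)
open import Data.Nat.Properties hiding (_≟_)
open import Data.Nat.Solver using (module +-*-Solver)
open import Data.Bool using (Bool; true; false; not; _xor_; _∧_; T?)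
open import Data.Bool.Properties using (∧-zeroʳ; ∧-identityʳ)
open import Data.Fin using (Fin; zero; suc)
open import Data.Fin.Properties using (_≟_; all?; ¬∀⟶∃¬)
open import Data.List using (length; filter; tabulate)
open import Data.Product using (∃-syntax; _,_)
open import Data.Sum using (_⊎_; inj₁; inj₂)
open import Data.Empty using (⊥; ⊥-elim)
open import Relation.Nullary using (¬_; yes; no; contradiction)
open import Relation.Nullary.Decidable using (⌊_⌋; ⌊⌋-map′)
open import Relation.Unary using (Pred; Decidable)
open import Relation.Binary.PropositionalEquality
open import Function using (_∘_; id)
open import Algebra.Properties.Semiring.Sum +-*-semiring
  using (sum; sum-syntax; sum-cong-≗; ∑-distrib-+; ∑-comm; sum-replicate-zero; *-distribʳ-sum)

𝟙 : Bool → ℕ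
𝟙 true  = 1
𝟙 false = 0

count : ∀ {n} → (Fin n → Bool) → ℕ
count p = sum (𝟙 ∘ p)

∑-mono-≤ : ∀ {n} {f g : Fin n → ℕ} → (∀ i → f i ≤ g i) → sum f ≤ sum g
∑-mono-≤ {zero}  f≤g = z≤n
∑-mono-≤ {suc n} f≤g = +-mono-≤ (f≤g zero) (∑-mono-≤ (f≤g ∘ suc))

length-filter-tabulate : ∀ {n m} (g : Fin n → Fin m) (p : Fin m → Bool) →
  length (filter (T? ∘ p) (tabulate g)) ≡ count (p ∘ g)
length-filter-tabulate {zero}  g p = refl
length-filter-tabulate {suc n} g p with p (g zero)
... | true  = cong suc (length-filter-tabulate (g ∘ suc) p)
... | false = length-filter-tabulate (g ∘ suc) p

countV≡count : ∀ {n} (p : Fin n → Bool) → countV p ≡ count p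
countV≡count = length-filter-tabulate id

count-∧ˡ : ∀ {n} c (p : Fin n → Bool) → count (λ z → c ∧ p z) ≡ 𝟙 c * count p
count-∧ˡ {n} false p = sum-replicate-zero n
count-∧ˡ     true  p = sym (+-identityʳ (count p))

∑-𝟙*≡count* : ∀ {n} (p : Fin n → Bool) c → sum (λ z → 𝟙 (p z) * c) ≡ count p * c
∑-𝟙*≡count* p c = sym (*-distribʳ-sum c (𝟙 ∘ p))

∑-count-∧-≤ : ∀ {n} (p : Fin n → Bool) (q : Fin n → Fin n → Bool) {K} →
  (∀ a → count (q a) ≤ K) → sum (λ a → count (λ b → p a ∧ q a b)) ≤ count p * K
∑-count-∧-≤ p q {K} q≤K = begin
  sum (λ a → count (λ b → p a ∧ q a b))  ≡⟨ sum-cong-≗ (λ a → count-∧ˡ (p a) (q a)) ⟩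
  sum (λ a → 𝟙 (p a) * count (q a))       ≤⟨ ∑-mono-≤ (λ a → *-monoʳ-≤ (𝟙 (p a)) (q≤K a)) ⟩
  sum (λ a → 𝟙 (p a) * K)                 ≡⟨ ∑-𝟙*≡count* p K ⟩
  count p * K                             ∎
  where open ≤-Reasoning

count-≟ : ∀ {n} (a : Fin n) → count (λ b → ⌊ a ≟ b ⌋) ≡ 1
count-≟ {suc n} zero    = cong suc (sum-replicate-zero n)
count-≟ {suc n} (suc a) = trans (sum-cong-≗ (λ b → cong 𝟙 (⌊⌋-map′ _ _ (a ≟ b)))) (count-≟ a)

𝟙-split : ∀ c e → 𝟙 c ≤ 𝟙 (c ∧ not e) + 𝟙 e
𝟙-split true  true  = s≤s z≤n
𝟙-split true  false = s≤s z≤n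
𝟙-split false e     = z≤n

count≤count-without+1 : ∀ {n} (p : Fin n → Bool) a →
  count p ≤ count (λ b → p b ∧ not ⌊ a ≟ b ⌋) + 1
count≤count-without+1 {n} p a = begin
  count p                                   ≤⟨ ∑-mono-≤ (λ b → 𝟙-split (p b) ⌊ a ≟ b ⌋) ⟩
  sum (λ b → 𝟙 (p′ b) + 𝟙 ⌊ a ≟ b ⌋)        ≡⟨ ∑-distrib-+ (𝟙 ∘ p′) (λ b → 𝟙 ⌊ a ≟ b ⌋) ⟩
  count p′ + count (λ b → ⌊ a ≟ b ⌋)        ≡⟨ cong (count p′ +_) (count-≟ a) ⟩
  count p′ + 1                              ∎
  where
  open ≤-Reasoning
  p′ : Fin n → Bool
  p′ b = p b ∧ not ⌊ a ≟ b ⌋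

large-factors-violate : ∀ K p q → 2 * K + 1 < p → 2 * K + 1 < q → p * K + q * K + p < p * q
large-factors-violate K p q 2K+1<p 2K+1<q = begin-strict
  p * K + q * K + p      <⟨ m<m+n (p * K + q * K + p) (≤-trans (s≤s z≤n) 2K+1<q) ⟩
  p * K + q * K + p + q  ≡⟨ solve 3 (λ K p q → p :* K :+ q :* K :+ p :+ q := (con 1 :+ K) :* (p :+ q)) refl K p q ⟩
  suc K * (p + q)        ≤⟨ *-cancelˡ-≤ 2 doubled ⟩
  p * q                  ∎
  where
  open ≤-Reasoning
  open +-*-Solver
  doubled : 2 * (suc K * (p + q)) ≤ 2 * (p * q)
  doubled = begin
    2 * (suc K * (p + q))              ≡⟨ solve 3 (λ K p q → con 2 :* ((con 1 :+ K) :* (p :+ q))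
                                                   := (con 1 :+ (con 2 :* K :+ con 1)) :* p :+ (con 1 :+ (con 2 :* K :+ con 1)) :* q) refl K p q ⟩
    suc (2 * K + 1) * p + suc (2 * K + 1) * q  ≤⟨ +-mono-≤ (*-monoˡ-≤ p 2K+1<q) (*-monoˡ-≤ q 2K+1<p) ⟩
    q * p + p * q                      ≡⟨ solve 2 (λ p q → q :* p :+ p :* q := con 2 :* (p :* q)) refl p q ⟩
    2 * (p * q)                        ∎

⌊≟⌋-sym : ∀ {n} (a b : Fin n) → ⌊ a ≟ b ⌋ ≡ ⌊ b ≟ a ⌋
⌊≟⌋-sym a b with a ≟ b | b ≟ a
... | yes _   | yes _   = refl
... | no _    | no _    = refl
... | yes a≡b | no b≢a  = contradiction (sym a≡b) b≢a
... | no a≢b  | yes b≡a = contradiction (sym b≡a) a≢b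

separation-cases : ∀ x~a a~b w~b w≡b a≡b a≡x →
  𝟙 (x~a ∧ ((not w~b ∧ not w≡b) ∧ not a≡b)) ≤
  𝟙 (x~a ∧ ((a~b ∧ not w≡b) xor (w~b ∧ not a≡b))) +
  𝟙 ((not w~b ∧ not w≡b) ∧ ((a~b ∧ not a≡x) xor (x~a ∧ not a≡b)))
separation-cases false a~b   w~b   w≡b   a≡b   a≡x = z≤n
separation-cases true  a~b   true  w≡b   a≡b   a≡x = z≤n
separation-cases true  a~b   false true  a≡b   a≡x = z≤n
separation-cases true  a~b   false false true  a≡x = z≤n
separation-cases true  true  false false false a≡x = s≤s z≤n
separation-cases true  false false false false a≡x = s≤s z≤n

module _ {n} (G : Graph n) where

  coadj : Fin n → Fin n → Bool
  coadj w b = not (adj G w b) ∧ not ⌊ w ≟ b ⌋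

  separates : Fin n → Fin n → Fin n → Bool
  separates x y z = (adj G x z ∧ not ⌊ z ≟ y ⌋) xor (adj G y z ∧ not ⌊ z ≟ x ⌋)

  degree≡count : ∀ x → degree G x ≡ count (adj G x)
  degree≡count x = countV≡count (adj G x)

  adj-complement : ∀ w b → adj (complement G) w b ≡ coadj w b
  adj-complement w b with w ≟ b
  ... | yes _ = sym (∧-zeroʳ (not (adj G w b)))
  ... | no _  = sym (∧-identityʳ (not (adj G w b)))

  degree-complement≡count : ∀ w → degree (complement G) w ≡ count (coadj w)
  degree-complement≡count w =
    trans (countV≡count (adj (complement G) w)) (sum-cong-≗ (cong 𝟙 ∘ adj-complement w))

  nbdist≡count : ∀ x y → nbdist G x y ≡ count (separates x y)
  nbdist≡count x y = countV≡count (separates x y)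

  pair-separated : ∀ x w a b →
    𝟙 (adj G x a ∧ (coadj w b ∧ not ⌊ a ≟ b ⌋)) ≤ 𝟙 (adj G x a ∧ separates a w b) + 𝟙 (coadj w b ∧ separates b x a)
  pair-separated x w a b rewrite ⌊≟⌋-sym b w | ⌊≟⌋-sym b a | adj-sym G b a =
    separation-cases (adj G x a) (adj G a b) (adj G w b) ⌊ w ≟ b ⌋ ⌊ a ≟ b ⌋ ⌊ a ≟ x ⌋

  module _ (x w : Fin n) where

    pairs : Fin n → Fin n → ℕ
    pairs a b = 𝟙 (adj G x a ∧ (coadj w b ∧ not ⌊ a ≟ b ⌋))

    ∑pairs-lower : count (adj G x) * count (coadj w) ≤ ∑[ a < n ] ∑[ b < n ] pairs a b + count (adj G x)
    ∑pairs-lower = begin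
      count (adj G x) * count (coadj w)              ≡⟨ ∑-𝟙*≡count* (adj G x) (count (coadj w)) ⟨
      ∑[ a < n ] (𝟙 (adj G x a) * count (coadj w))   ≤⟨ ∑-mono-≤ row ⟩
      ∑[ a < n ] (sum (pairs a) + 𝟙 (adj G x a))     ≡⟨ ∑-distrib-+ (sum ∘ pairs) (𝟙 ∘ adj G x) ⟩
      ∑[ a < n ] sum (pairs a) + count (adj G x)     ∎
      where
      open ≤-Reasoning
      row : ∀ a → 𝟙 (adj G x a) * count (coadj w) ≤ sum (pairs a) + 𝟙 (adj G x a)
      row a = begin
        𝟙 c * count (coadj w)          ≤⟨ *-monoʳ-≤ (𝟙 c) (count≤count-without+1 (coadj w) a) ⟩
        𝟙 c * (count others + 1)       ≡⟨ *-distribˡ-+ (𝟙 c) (count others) 1 ⟩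
        𝟙 c * count others + 𝟙 c * 1   ≡⟨ cong₂ _+_ (sym (count-∧ˡ c others)) (*-identityʳ (𝟙 c)) ⟩
        sum (pairs a) + 𝟙 c            ∎
        where
        c : Bool
        c = adj G x a
        others : Fin n → Bool
        others b = coadj w b ∧ not ⌊ a ≟ b ⌋

    ∑pairs-upper : ∀ {K} → (∀ y z → nbdist G y z ≤ K) →
      ∑[ a < n ] ∑[ b < n ] pairs a b ≤ count (adj G x) * K + count (coadj w) * K
    ∑pairs-upper {K} δ≤K = begin
      ∑[ a < n ] ∑[ b < n ] pairs a b
        ≤⟨ ∑-mono-≤ (λ a → ∑-mono-≤ (pair-separated x w a)) ⟩
      ∑[ a < n ] ∑[ b < n ] (f a b + g b a)
        ≡⟨ sum-cong-≗ (λ a → ∑-distrib-+ (f a) (λ b → g b a)) ⟩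
      ∑[ a < n ] (sum (f a) + ∑[ b < n ] g b a)
        ≡⟨ ∑-distrib-+ (sum ∘ f) (λ a → ∑[ b < n ] g b a) ⟩
      ∑[ a < n ] sum (f a) + ∑[ a < n ] ∑[ b < n ] g b a
        ≡⟨ cong (∑[ a < n ] sum (f a) +_) (∑-comm (λ a b → g b a)) ⟩
      ∑[ a < n ] sum (f a) + ∑[ b < n ] sum (g b)
        ≤⟨ +-mono-≤ (∑-count-∧-≤ (adj G x) (λ a → separates a w) (λ a → δ≤K′ a w))
                    (∑-count-∧-≤ (coadj w) (λ b → separates b x) (λ b → δ≤K′ b x)) ⟩
      count (adj G x) * K + count (coadj w) * K
        ∎
      where
      open ≤-Reasoning
      f g : Fin n → Fin n → ℕ
      f a b = 𝟙 (adj G x a ∧ separates a w b)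
      g b a = 𝟙 (coadj w b ∧ separates b x a)
      δ≤K′ : ∀ y z → count (separates y z) ≤ K
      δ≤K′ y z = subst (_≤ K) (nbdist≡count y z) (δ≤K y z)

  degree-product-bound : ∀ {K} → (∀ y z → nbdist G y z ≤ K) → ∀ x w →
    degree G x * degree (complement G) w ≤ degree G x * K + degree (complement G) w * K + degree G x
  degree-product-bound δ≤K x w rewrite degree≡count x | degree-complement≡count w =
    ≤-trans (∑pairs-lower x w) (+-monoˡ-≤ (count (adj G x)) (∑pairs-upper x w δ≤K))

∀⊎∀ : ∀ {n p q} {P : Pred (Fin n) p} {Q : Pred (Fin n) q} → Decidable P → Decidable Q →
  (∀ x y → ¬ P x → ¬ Q y → ⊥) → (∀ x → P x) ⊎ (∀ y → Q y)
∀⊎∀ {n} P? Q? no-pair with all? P? | all? Q?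
... | yes ∀P  | _        = inj₁ ∀P
... | no _    | yes ∀Q   = inj₂ ∀Q
... | no ¬∀P  | no ¬∀Q   with ¬∀⟶∃¬ n _ P? ¬∀P | ¬∀⟶∃¬ n _ Q? ¬∀Q
...   | x , ¬Px | y , ¬Qy = ⊥-elim (no-pair x y ¬Px ¬Qy)

proposition2p1 : ∀ (K : ℕ) → ∃[ Δ ] (∀ (n : ℕ) (G : Graph n) →
    (∀ (x y : Fin n) → nbdist G x y ≤ K) →
    MaxDegreeAtMost G Δ ⊎ MaxDegreeAtMost (complement G) Δ)
proposition2p1 K = 2 * K + 1 , λ n G δ≤K →
  ∀⊎∀ (λ x → degree G x ≤? 2 * K + 1) (λ w → degree (complement G) w ≤? 2 * K + 1)
      (λ x w x-large w-large →
         <⇒≱ (large-factors-violate K _ _ (≰⇒> x-large) (≰⇒> w-large))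
             (degree-product-bound G δ≤K x w))
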